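{- Consider chip configurations $z=(z_0,\dots,z_4)\in\mathbb Z[i]^5$ on the nodes $0,1,2,3,4$ of a pentagon, with two configurations $z,z'$ called firing equivalent if $z-z'\in\overline{\mathcal K}\,\mathbb Z[i]^5$, where \[\overline{\mathcal K}=\begin{bmatrix} 1 + i & -i & 0 & 0 & -i \\ -i & 1 + i & -i & 0 & 0 \\ 0 & -i & 1 + i & -i & 0 \\ 0 & 0 & -i & 1 + i & -i \\ -i & 0 & 0 & -i & 1 + i \end{bmatrix}.\] Then every firing equivalence class contains a configuration with no imaginary chips, i.e. a configuration $z\in\mathbb Z^5\subset\mathbb Z[i]^5$.
   Context: For a configuration $z$, node $k$ carries $\operatorname{Re} z_k$ real chips and $\operatorname{Im} z_k$ imaginary chips. Nodes $k$ and $k\pm1 \pmod 5$ are neighbors. Firing equivalence is equivalently generated by the moves: (A) add $1+i$ to a node and $-i$ to each of its two neighbors; (B) add $-1+i$ to a node and $1$ to each neighbor; and their negatives. The group $\mathbb Z[i]^5/\overline{\mathcal K}\,\mathbb Z[i]^5$ of firing equivalence classes is isomorphic to the sandpile group $S(R_{10})$ of the matroid $R_{10}$ represented over $\mathbb R$ by $\begin{bmatrix} I_5 & \mathcal D\end{bmatrix}$ with $\overline{\mathcal K}=I_5+i\mathcal D$. -}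

module Defs where

open import Data.Integer using (ℤ; +_; -_) renaming (_+_ to _+ℤ_; _*_ to _*ℤ_; _-_ to _-ℤ_)
open import Data.Fin using (Fin; zero; suc)
open import Data.Product using (Σ; _×_; _,_; proj₁; proj₂)
open import Relation.Binary.PropositionalEquality using (_≡_)

record ℤ[i] : Set where
  constructor _+_i
  field
    re : ℤ
    im : ℤ
open ℤ[i] public

0ᵍ : ℤ[i]
0ᵍ = (+ 0) + (+ 0) i

_+ᵍ_ : ℤ[i] → ℤ[i] → ℤ[i]
(a + b i) +ᵍ (c + d i) = (a +ℤ c) + (b +ℤ d) i

_-ᵍ_ : ℤ[i] → ℤ[i] → ℤ[i]
(a + b i) -ᵍ (c + d i) = (a -ℤ c) + (b -ℤ d) i

_*ᵍ_ : ℤ[i] → ℤ[i] → ℤ[i]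
(a + b i) *ᵍ (c + d i) = ((a *ℤ c) -ℤ (b *ℤ d)) + ((a *ℤ d) +ℤ (b *ℤ c)) i

Config : Set
Config = Fin 5 → ℤ[i]

1+i : ℤ[i]
1+i = (+ 1) + (+ 1) i

-i : ℤ[i]
-i = (+ 0) + (- (+ 1)) i

Kbar : Fin 5 → Fin 5 → ℤ[i]
Kbar zero zero = 1+i
Kbar zero (suc zero) = -i
Kbar zero (suc (suc (suc (suc zero)))) = -i
Kbar (suc zero) zero = -i
Kbar (suc zero) (suc zero) = 1+i
Kbar (suc zero) (suc (suc zero)) = -i
Kbar (suc (suc zero)) (suc zero) = -i
Kbar (suc (suc zero)) (suc (suc zero)) = 1+i
Kbar (suc (suc zero)) (suc (suc (suc zero))) = -i
Kbar (suc (suc (suc zero))) (suc (suc zero)) = -i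
Kbar (suc (suc (suc zero))) (suc (suc (suc zero))) = 1+i
Kbar (suc (suc (suc zero))) (suc (suc (suc (suc zero)))) = -i
Kbar (suc (suc (suc (suc zero)))) zero = -i
Kbar (suc (suc (suc (suc zero)))) (suc (suc (suc zero))) = -i
Kbar (suc (suc (suc (suc zero)))) (suc (suc (suc (suc zero)))) = 1+i
Kbar _ _ = 0ᵍ

Σ5 : (Fin 5 → ℤ[i]) → ℤ[i]
Σ5 f = f zero +ᵍ (f (suc zero) +ᵍ (f (suc (suc zero)) +ᵍ (f (suc (suc (suc zero))) +ᵍ f (suc (suc (suc (suc zero)))))))

Kbar·_ : Config → Config
(Kbar· w) j = Σ5 (λ k → Kbar j k *ᵍ w k)

FiringEquiv : Config → Config → Set
FiringEquiv z z' = Σ Config (λ w → (j : Fin 5) → (z j -ᵍ z' j) ≡ (Kbar· w) j)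

NoImaginary : Config → Set
NoImaginary z = (j : Fin 5) → im (z j) ≡ + 0

-- Fire every node k exactly Im z k times along i, i.e. subtract K̄ (i b) with b = Im z.
-- Since K̄ = I₅ + i 𝒟 with 𝒟 real, the imaginary part of K̄ (i b) is b itself,
-- so the result is firing equivalent to z and has no imaginary chips.
module Submission where

open import Defs
open import Data.Product using (Σ; _×_; _,_)
open import Data.Fin using (Fin; zero; suc)
open import Data.Integer using (ℤ; +_) renaming (_+_ to _+ℤ_; _*_ to _*ℤ_; _-_ to _-ℤ_)
open import Data.Integer.Properties using (+-identityˡ; +-identityʳ; *-identityˡ; +-inverseʳ)
open import Data.Integer.Tactic.RingSolver using (solve-∀)
open import Relation.Binary.PropositionalEquality using (_≡_; trans; cong; cong₂)
open Relation.Binary.PropositionalEquality.≡-Reasoning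

x-[x-y]≡y : ∀ x y → x -ᵍ (x -ᵍ y) ≡ y
x-[x-y]≡y (a + b i) (c + d i) = cong₂ _+_i (cancel a c) (cancel b d)
  where
  cancel : ∀ m n → m -ℤ (m -ℤ n) ≡ n
  cancel = solve-∀

fire : (z w : Config) → FiringEquiv z (λ j → z j -ᵍ (Kbar· w) j)
fire z w = w , λ j → x-[x-y]≡y (z j) ((Kbar· w) j)

1*x+0+0≡x : ∀ x → (+ 1 *ℤ x +ℤ + 0) +ℤ + 0 ≡ x
1*x+0+0≡x = solve-∀

i· : ℤ → ℤ[i]
i· b = (+ 0) + b i

-- Off-diagonal entries of K̄ have zero real part, so their terms reduce to + 0 (those
-- before the diagonal leave a stuck + 0 +ℤ _); the diagonal entry 1 + i contributes 1 · b j.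
im-Kbar·-i· : ∀ (b : Fin 5 → ℤ) j → im ((Kbar· λ k → i· (b k)) j) ≡ b j
im-Kbar·-i· b zero = 1*x+0+0≡x (b zero)
im-Kbar·-i· b (suc zero) =
  trans (+-identityˡ _) (1*x+0+0≡x (b (suc zero)))
im-Kbar·-i· b (suc (suc zero)) =
  trans (+-identityˡ _) (trans (+-identityˡ _) (1*x+0+0≡x (b (suc (suc zero)))))
im-Kbar·-i· b (suc (suc (suc zero))) =
  trans (+-identityˡ _) (trans (+-identityˡ _) (trans (+-identityˡ _)
    (1*x+0+0≡x (b (suc (suc (suc zero)))))))
im-Kbar·-i· b (suc (suc (suc (suc zero)))) =
  trans (+-identityˡ _) (trans (+-identityˡ _) (trans (+-identityˡ _) (trans (+-identityˡ _)
    (trans (+-identityʳ _) (*-identityˡ (b (suc (suc (suc (suc zero))))))))))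

lemma3p3 : (z : Config) → Σ Config (λ z' → FiringEquiv z z' × NoImaginary z')
lemma3p3 z = z' , fire z w , no-imaginary
  where
  w : Config
  w k = i· (im (z k))

  z' : Config
  z' j = z j -ᵍ (Kbar· w) j

  no-imaginary : NoImaginary z'
  no-imaginary j = begin
    im (z j) -ℤ im ((Kbar· w) j) ≡⟨ cong (im (z j) -ℤ_) (im-Kbar·-i· (λ k → im (z k)) j) ⟩
    im (z j) -ℤ im (z j)         ≡⟨ +-inverseʳ (im (z j)) ⟩
    + 0                          ∎
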